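{- For every nonnegative integer $n$ and every complex number $x$, $${}_3F_2\left[\begin{matrix} 3x,\ -3x,\ -n\\ \tfrac12,\ -3n\end{matrix}\middle|\frac34\right]=\frac12\left[\begin{matrix} \frac13+x,\ \frac23-x\\ \frac13,\ \frac23\end{matrix}\right]_n+\frac12\left[\begin{matrix} \frac23+x,\ \frac13-x\\ \frac13,\ \frac23\end{matrix}\right]_n.$$
   Context: For a complex number $a$ and a nonnegative integer $m$, $(a)_m=a(a+1)\cdots(a+m-1)$ with $(a)_0=1$. The bracket notation means $\left[\begin{matrix} a_1,\dots,a_r\\ b_1,\dots,b_s\end{matrix}\right]_m=\frac{(a_1)_m\cdots(a_r)_m}{(b_1)_m\cdots(b_s)_m}$. For a nonnegative integer $n$, ${}_3F_2\left[\begin{matrix} a,\ b,\ -n\\ d,\ e\end{matrix}\middle|z\right]=\sum_{k=0}^{n}\frac{(a)_k(b)_k(-n)_k}{k!\,(d)_k(e)_k}z^k$. -}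

module Defs where

open import Level using (Level; _⊔_)
open import Data.Nat as ℕ using (ℕ; zero; suc; _!)
open import Algebra.Bundles using (CommutativeRing)
open import Relation.Nullary using (¬_)

ringFromℕ : ∀ {c ℓ} (R : CommutativeRing c ℓ) → ℕ → CommutativeRing.Carrier R
ringFromℕ R zero    = CommutativeRing.0# R
ringFromℕ R (suc n) = CommutativeRing._+_ R (CommutativeRing.1# R) (ringFromℕ R n)

-- The inverse is total; only its value on nonzero elements is constrained
-- (all denominators occurring in the statement are nonzero in characteristic zero).
record CharZeroField (c ℓ : Level) : Set (Level.suc (c ⊔ ℓ)) where
  field
    commutativeRing : CommutativeRing c ℓ
  open CommutativeRing commutativeRing
  field
    _⁻¹        : Carrier → Carrier
    ⁻¹-cong    : ∀ {x y} → x ≈ y → x ⁻¹ ≈ y ⁻¹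
    inverseʳ   : ∀ x → ¬ (x ≈ 0#) → x * (x ⁻¹) ≈ 1#
    nontrivial : ¬ (1# ≈ 0#)
    char-zero  : ∀ n → ¬ (ringFromℕ commutativeRing (suc n) ≈ 0#)

module FieldOps {c ℓ} (F : CharZeroField c ℓ) where
  open CharZeroField F public
  open CommutativeRing commutativeRing public hiding (zero)

  fromℕ : ℕ → Carrier
  fromℕ = ringFromℕ commutativeRing

  infixl 7 _/_
  _/_ : Carrier → Carrier → Carrier
  a / b = a * (b ⁻¹)

  infixr 8 _^_
  _^_ : Carrier → ℕ → Carrier
  a ^ zero  = 1#
  a ^ suc m = (a ^ m) * a

  poch : Carrier → ℕ → Carrier
  poch a zero    = 1#
  poch a (suc m) = poch a m * (a + fromℕ m)

  sumTo : ℕ → (ℕ → Carrier) → Carrier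
  sumTo zero    f = f zero
  sumTo (suc n) f = sumTo n f + f (suc n)

  -- 3F2[a, b, -n; d, e | z] = Σ_{k=0}^{n} (a)_k (b)_k (-n)_k z^k / (k! (d)_k (e)_k)
  F32 : Carrier → Carrier → ℕ → Carrier → Carrier → Carrier → Carrier
  F32 a b n d e z =
    sumTo n (λ k → (poch a k * poch b k * poch (- fromℕ n) k * (z ^ k))
                   / (fromℕ (k !) * poch d k * poch e k))

-- Put y = 3x, c(n,k) = (-n)ₖ 3ᵏ / ((2k)! (-3n)ₖ) and S n y = Σ_{k ≤ n} c(n,k) (y)ₖ (1-y)ₖ.
-- Since (2k)! = 4ᵏ k! (½)ₖ and (y)ₖ(1-y)ₖ + (-y)ₖ(1+y)ₖ = 2 (y)ₖ(-y)ₖ, the ₃F₂ equals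
-- ½ (S n y + S n (-y)), so it suffices that S n (3x) = (⅓+x)ₙ (⅔-x)ₙ / ((⅓)ₙ (⅔)ₙ).
-- With A = (3n+1)(3n+2), the sequence Vₖ = (y)ₖ(1-y)ₖ satisfies
-- (3n+1+y)(3n+2-y) Vₖ = (A - k(k+1)) Vₖ + Vₖ₊₁, and the coefficients satisfy the contiguous relation
-- A c(n+1,k) = (A - k(k+1)) c(n,k) + c(n,k-1); after clearing denominators the latter is a
-- cubic polynomial identity in n and k. Summing by parts gives
-- (3n+1+y)(3n+2-y) S n y = A S (n+1) y, which is the step of an induction on n, since
-- 9 (⅓+x+n)(⅔-x+n) = (3n+1+3x)(3n+2-3x) and 9 (⅓+n)(⅔+n) = A.

module Submission where

open import Defs
open import Algebra.Bundles using (CommutativeRing)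
import Data.Nat
open import Data.Nat as ℕ using (ℕ; zero; suc; _!)
open import Data.Integer as ℤ using (ℤ; +_; -[1+_])
import Data.Integer.Properties as ℤ
import Data.Nat.Properties as ℕₚ
open import Data.Maybe using (Maybe; just; nothing)
open import Relation.Nullary using (yes; no)
open import Relation.Binary.PropositionalEquality as ≡ using (_≡_; _≢_)
open import Data.Empty using (⊥-elim)
open import Data.Sum using (inj₁; inj₂)
import Algebra.Properties.Ring as RingProperties
import Relation.Binary.Reasoning.Setoid as SetoidReasoning
open import Algebra.Solver.Ring.AlmostCommutativeRing
  using (_-Raw-AlmostCommutative⟶_; fromCommutativeRing)

module IntegerCoefficientSolver {c ℓ} (R : CommutativeRing c ℓ) where
  open CommutativeRing R
  open RingProperties ring
  open SetoidReasoning setoid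

  fromℕ : ℕ → Carrier
  fromℕ = ringFromℕ R

  fromℕ-+ : ∀ m n → fromℕ (m ℕ.+ n) ≈ fromℕ m + fromℕ n
  fromℕ-+ zero    n = sym (+-identityˡ _)
  fromℕ-+ (suc m) n = trans (+-congˡ (fromℕ-+ m n)) (sym (+-assoc _ _ _))

  fromℕ-* : ∀ m n → fromℕ (m ℕ.* n) ≈ fromℕ m * fromℕ n
  fromℕ-* zero    n = sym (zeroˡ _)
  fromℕ-* (suc m) n = begin
    fromℕ (n ℕ.+ m ℕ.* n)            ≈⟨ fromℕ-+ n (m ℕ.* n) ⟩
    fromℕ n + fromℕ (m ℕ.* n)        ≈⟨ +-cong (sym (*-identityˡ _)) (fromℕ-* m n) ⟩
    1# * fromℕ n + fromℕ m * fromℕ n ≈⟨ distribʳ _ _ _ ⟨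
    (1# + fromℕ m) * fromℕ n         ∎

  fromℤ : ℤ → Carrier
  fromℤ (+ n)    = fromℕ n
  fromℤ -[1+ n ] = - fromℕ (suc n)

  fromℤ-⊖ : ∀ m n → fromℤ (m ℤ.⊖ n) ≈ fromℕ m - fromℕ n
  fromℤ-⊖ zero    zero    = sym (trans (+-congˡ -0#≈0#) (+-identityʳ _))
  fromℤ-⊖ zero    (suc n) = sym (+-identityˡ _)
  fromℤ-⊖ (suc m) zero    = sym (trans (+-congˡ -0#≈0#) (+-identityʳ _))
  fromℤ-⊖ (suc m) (suc n) rewrite ℤ.[1+m]⊖[1+n]≡m⊖n m n = begin
    fromℤ (m ℤ.⊖ n)                 ≈⟨ fromℤ-⊖ m n ⟩
    fromℕ m - fromℕ n               ≈⟨ +-identityˡ _ ⟨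
    0# + (fromℕ m - fromℕ n)        ≈⟨ +-congʳ (-‿inverseʳ 1#) ⟨
    (1# - 1#) + (fromℕ m - fromℕ n) ≈⟨ +-assoc _ _ _ ⟩
    1# + (- 1# + (fromℕ m - fromℕ n)) ≈⟨ +-congˡ (sym (+-assoc _ _ _)) ⟩
    1# + ((- 1# + fromℕ m) - fromℕ n) ≈⟨ +-congˡ (+-congʳ (+-comm _ _)) ⟩
    1# + ((fromℕ m - 1#) - fromℕ n) ≈⟨ +-congˡ (+-assoc _ _ _) ⟩
    1# + (fromℕ m + (- 1# - fromℕ n)) ≈⟨ sym (+-assoc _ _ _) ⟩
    (1# + fromℕ m) + (- 1# - fromℕ n) ≈⟨ +-congˡ (-‿+-comm 1# (fromℕ n)) ⟩
    fromℕ (suc m) - fromℕ (suc n)   ∎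

  fromℤ-neg : ∀ i → fromℤ (ℤ.- i) ≈ - fromℤ i
  fromℤ-neg -[1+ n ]  = sym (-‿involutive _)
  fromℤ-neg (+ zero)  = sym -0#≈0#
  fromℤ-neg (+ suc n) = refl

  fromℤ-+ : ∀ i j → fromℤ (i ℤ.+ j) ≈ fromℤ i + fromℤ j
  fromℤ-+ -[1+ m ] -[1+ n ] = begin
    - (1# + fromℕ (suc (m ℕ.+ n)))  ≈⟨ -‿cong (+-congˡ (reflexive (≡.cong fromℕ (ℕₚ.+-suc m n)))) ⟨
    - (1# + fromℕ (m ℕ.+ suc n))    ≈⟨ -‿cong (+-congˡ (fromℕ-+ m (suc n))) ⟩
    - (1# + (fromℕ m + fromℕ (suc n))) ≈⟨ -‿cong (+-assoc _ _ _) ⟨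
    - (fromℕ (suc m) + fromℕ (suc n)) ≈⟨ -‿+-comm _ _ ⟨
    - fromℕ (suc m) - fromℕ (suc n) ∎
  fromℤ-+ -[1+ m ] (+ n)    = trans (fromℤ-⊖ n (suc m)) (+-comm _ _)
  fromℤ-+ (+ m)    -[1+ n ] = fromℤ-⊖ m (suc n)
  fromℤ-+ (+ m)    (+ n)    = fromℕ-+ m n

  fromℤ-*-+ : ∀ m j → fromℤ (+ m ℤ.* j) ≈ fromℕ m * fromℤ j
  fromℤ-*-+ m (+ n)    = trans (reflexive (≡.cong fromℤ (≡.sym (ℤ.pos-* m n)))) (fromℕ-* m n)
  fromℤ-*-+ m -[1+ n ] = begin
    fromℤ (+ m ℤ.* ℤ.- + suc n)     ≡⟨ ≡.cong fromℤ (ℤ.neg-distribʳ-* (+ m) (+ suc n)) ⟨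
    fromℤ (ℤ.- (+ m ℤ.* + suc n))   ≈⟨ fromℤ-neg (+ m ℤ.* + suc n) ⟩
    - fromℤ (+ m ℤ.* + suc n)       ≈⟨ -‿cong (fromℤ-*-+ m (+ suc n)) ⟩
    - (fromℕ m * fromℕ (suc n))     ≈⟨ -‿distribʳ-* _ _ ⟩
    fromℕ m * - fromℕ (suc n)       ∎

  fromℤ-* : ∀ i j → fromℤ (i ℤ.* j) ≈ fromℤ i * fromℤ j
  fromℤ-* (+ m)    j = fromℤ-*-+ m j
  fromℤ-* -[1+ m ] j = begin
    fromℤ (ℤ.- + suc m ℤ.* j)       ≡⟨ ≡.cong fromℤ (ℤ.neg-distribˡ-* (+ suc m) j) ⟨
    fromℤ (ℤ.- (+ suc m ℤ.* j))     ≈⟨ fromℤ-neg (+ suc m ℤ.* j) ⟩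
    - fromℤ (+ suc m ℤ.* j)         ≈⟨ -‿cong (fromℤ-*-+ (suc m) j) ⟩
    - (fromℕ (suc m) * fromℤ j)     ≈⟨ -‿distribˡ-* _ _ ⟩
    - fromℕ (suc m) * fromℤ j       ∎

  fromℤ-homomorphism : ℤ.+-*-rawRing -Raw-AlmostCommutative⟶ fromCommutativeRing R
  fromℤ-homomorphism = record
    { ⟦_⟧ = fromℤ ; +-homo = fromℤ-+ ; *-homo = fromℤ-* ; -‿homo = fromℤ-neg
    ; 0-homo = refl ; 1-homo = +-identityʳ 1# }

  fromℤ-≟ : ∀ i j → Maybe (fromℤ i ≈ fromℤ j)
  fromℤ-≟ i j with i ℤ.≟ j
  ... | yes ≡.refl = just refl
  ... | no _       = nothing

  open import Algebra.Solver.Ring ℤ.+-*-rawRing (fromCommutativeRing R) fromℤ-homomorphism fromℤ-≟ public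

  -- con (+ 1) denotes fromℕ 1 = 1# + 0#, not 1#; the empty product is exactly 1#.
  :1 : ∀ {m} → Polynomial m
  :1 = con (+ 0) :^ 0

module Summation {c ℓ} (F : CharZeroField c ℓ) where
  open FieldOps F
  open IntegerCoefficientSolver commutativeRing hiding (fromℕ)
  open RingProperties ring
  open SetoidReasoning setoid

  x⁻¹*[x*y]≈y : ∀ {a} x → a ≉ 0# → a ⁻¹ * (a * x) ≈ x
  x⁻¹*[x*y]≈y {a} x a≉0 = begin
    a ⁻¹ * (a * x) ≈⟨ solve 3 (λ a a⁻¹ x → a⁻¹ :* (a :* x) := a :* a⁻¹ :* x) refl a (a ⁻¹) x ⟩
    a * a ⁻¹ * x   ≈⟨ *-congʳ (inverseʳ a a≉0) ⟩
    1# * x         ≈⟨ *-identityˡ x ⟩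
    x              ∎

  *-cancelˡ : ∀ {a x y} → a ≉ 0# → a * x ≈ a * y → x ≈ y
  *-cancelˡ {a} {x} {y} a≉0 ax≈ay = begin
    x              ≈⟨ x⁻¹*[x*y]≈y x a≉0 ⟨
    a ⁻¹ * (a * x) ≈⟨ *-congˡ ax≈ay ⟩
    a ⁻¹ * (a * y) ≈⟨ x⁻¹*[x*y]≈y y a≉0 ⟩
    y              ∎

  *-≉0 : ∀ {a b} → a ≉ 0# → b ≉ 0# → a * b ≉ 0#
  *-≉0 {a} a≉0 b≉0 ab≈0 = b≉0 (*-cancelˡ a≉0 (trans ab≈0 (sym (zeroʳ a))))

  x*y≉0⇒y≉0 : ∀ {a b} → a * b ≉ 0# → b ≉ 0#
  x*y≉0⇒y≉0 {a} ab≉0 b≈0 = ab≉0 (trans (*-congˡ b≈0) (zeroʳ a))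

  ≉0-resp-≈ : ∀ {a b} → a ≈ b → a ≉ 0# → b ≉ 0#
  ≉0-resp-≈ a≈b a≉0 b≈0 = a≉0 (trans a≈b b≈0)

  x/y*y≈x : ∀ x {y} → y ≉ 0# → x / y * y ≈ x
  x/y*y≈x x {y} y≉0 = trans (*-assoc x (y ⁻¹) y)
    (trans (*-congˡ (trans (*-comm _ _) (inverseʳ y y≉0))) (*-identityʳ x))

  y*[x/y]≈x : ∀ x {y} → y ≉ 0# → y * (x / y) ≈ x
  y*[x/y]≈x x y≉0 = trans (*-comm _ _) (x/y*y≈x x y≉0)

  x≈1⇒x⁻¹≈1 : ∀ {a} → a ≈ 1# → a ⁻¹ ≈ 1#
  x≈1⇒x⁻¹≈1 {a} a≈1 = begin
    a ⁻¹     ≈⟨ *-identityˡ _ ⟨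
    1# * a ⁻¹ ≈⟨ *-congʳ a≈1 ⟨
    a * a ⁻¹ ≈⟨ inverseʳ a (≉0-resp-≈ (sym a≈1) nontrivial) ⟩
    1#       ∎

  x*y≈z⇒y≈z/x : ∀ {a x b} → a ≉ 0# → a * x ≈ b → x ≈ b / a
  x*y≈z⇒y≈z/x {a} {x} {b} a≉0 ax≈b = begin
    x              ≈⟨ x⁻¹*[x*y]≈y x a≉0 ⟨
    a ⁻¹ * (a * x) ≈⟨ *-congˡ ax≈b ⟩
    a ⁻¹ * b       ≈⟨ *-comm _ _ ⟩
    b / a          ∎

  cross-multiply : ∀ {a b c d x y} → b ≉ 0# → d ≉ 0# →
                   a * x * d ≈ c * y * b → a / b * x ≈ c / d * y
  cross-multiply {a} {b} {c} {d} {x} {y} b≉0 d≉0 axd≈cyb = *-cancelˡ (*-≉0 b≉0 d≉0) (begin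
    b * d * (a / b * x) ≈⟨ solve 5 (λ a b b⁻¹ d x → b :* d :* (a :* b⁻¹ :* x) := a :* b⁻¹ :* b :* x :* d)
                             refl a b (b ⁻¹) d x ⟩
    a / b * b * x * d   ≈⟨ *-congʳ (*-congʳ (x/y*y≈x a b≉0)) ⟩
    a * x * d           ≈⟨ axd≈cyb ⟩
    c * y * b           ≈⟨ *-congʳ (*-congʳ (x/y*y≈x c d≉0)) ⟨
    c / d * d * y * b   ≈⟨ solve 5 (λ c d d⁻¹ b y → c :* d⁻¹ :* d :* y :* b := b :* d :* (c :* d⁻¹ :* y))
                             refl c d (d ⁻¹) b y ⟩
    b * d * (c / d * y) ∎)

  fromℕ-≉0 : ∀ n .{{_ : ℕ.NonZero n}} → fromℕ n ≉ 0#
  fromℕ-≉0 (suc n) = char-zero n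

  fromℕ-injective : ∀ {m n} → fromℕ m ≈ fromℕ n → m ≡ n
  fromℕ-injective {zero}  {zero}  _ = ≡.refl
  fromℕ-injective {zero}  {suc n} 0≈n = ⊥-elim (char-zero n (sym 0≈n))
  fromℕ-injective {suc m} {zero}  m≈0 = ⊥-elim (char-zero m m≈0)
  fromℕ-injective {suc m} {suc n} 1+m≈1+n = ≡.cong suc (fromℕ-injective (begin
    fromℕ m                ≈⟨ cancel-1 (fromℕ m) ⟩
    - 1# + (1# + fromℕ m) ≈⟨ +-congˡ 1+m≈1+n ⟩
    - 1# + (1# + fromℕ n) ≈⟨ cancel-1 (fromℕ n) ⟨
    fromℕ n                ∎))
    where
    cancel-1 : ∀ x → x ≈ - 1# + (1# + x)
    cancel-1 = solve 1 (λ x → x := :- :1 :+ (:1 :+ x)) refl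

  -fromℕ+fromℕ≉0 : ∀ {m i} → i ≢ m → - fromℕ m + fromℕ i ≉ 0#
  -fromℕ+fromℕ≉0 {m} {i} i≢m -m+i≈0 = i≢m (fromℕ-injective (begin
    fromℕ i                         ≈⟨ solve 2 (λ m i → i := m :+ (:- m :+ i)) refl (fromℕ m) (fromℕ i) ⟩
    fromℕ m + (- fromℕ m + fromℕ i) ≈⟨ +-congˡ -m+i≈0 ⟩
    fromℕ m + 0#                    ≈⟨ +-identityʳ _ ⟩
    fromℕ m                         ∎))

  positive+fromℕ≉0 : ∀ {a} d e → fromℕ d * a ≈ fromℕ (suc e) → ∀ i → a + fromℕ i ≉ 0#
  positive+fromℕ≉0 {a} d e da≈1+e i a+i≈0 = char-zero (e ℕ.+ d ℕ.* i) (begin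
    fromℕ (suc e ℕ.+ d ℕ.* i)        ≈⟨ fromℕ-+ (suc e) (d ℕ.* i) ⟩
    fromℕ (suc e) + fromℕ (d ℕ.* i)  ≈⟨ +-cong (sym da≈1+e) (fromℕ-* d i) ⟩
    fromℕ d * a + fromℕ d * fromℕ i  ≈⟨ distribˡ _ _ _ ⟨
    fromℕ d * (a + fromℕ i)          ≈⟨ *-congˡ a+i≈0 ⟩
    fromℕ d * 0#                     ≈⟨ zeroʳ _ ⟩
    0#                               ∎)

  poch-cong : ∀ {a b} k → a ≈ b → poch a k ≈ poch b k
  poch-cong zero    a≈b = refl
  poch-cong (suc k) a≈b = *-cong (poch-cong k a≈b) (+-congʳ a≈b)

  poch-+ : ∀ a m k → poch a (m ℕ.+ k) ≈ poch a m * poch (a + fromℕ m) k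
  poch-+ a m zero rewrite ℕₚ.+-identityʳ m = sym (*-identityʳ _)
  poch-+ a m (suc k) rewrite ℕₚ.+-suc m k = begin
    poch a (m ℕ.+ k) * (a + fromℕ (m ℕ.+ k))
      ≈⟨ *-cong (poch-+ a m k) (+-congˡ (fromℕ-+ m k)) ⟩
    poch a m * poch (a + fromℕ m) k * (a + (fromℕ m + fromℕ k))
      ≈⟨ solve 5 (λ a m k p q → p :* q :* (a :+ (m :+ k)) := p :* (q :* (a :+ m :+ k)))
           refl a (fromℕ m) (fromℕ k) (poch a m) (poch (a + fromℕ m) k) ⟩
    poch a m * (poch (a + fromℕ m) k * (a + fromℕ m + fromℕ k)) ∎

  poch-sucˡ : ∀ a k → poch a (suc k) ≈ a * poch (a + 1#) k
  poch-sucˡ a k = trans (poch-+ a 1 k)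
    (*-cong (solve 1 (λ a → :1 :* (a :+ con (+ 0)) := a) refl a) (poch-cong k (+-congˡ (+-identityʳ 1#))))

  poch-≉0 : ∀ {a} k → (∀ i → i ℕ.< k → a + fromℕ i ≉ 0#) → poch a k ≉ 0#
  poch-≉0 zero    _          = nontrivial
  poch-≉0 (suc k) factors≉0 =
    *-≉0 (poch-≉0 k (λ i i<k → factors≉0 i (ℕₚ.m<n⇒m<1+n i<k))) (factors≉0 k ℕₚ.≤-refl)

  poch-negative-≉0 : ∀ {m k} → k ℕ.≤ m → poch (- fromℕ m) k ≉ 0#
  poch-negative-≉0 {k = k} k≤m =
    poch-≉0 k (λ i i<k → -fromℕ+fromℕ≉0 (ℕₚ.<⇒≢ (ℕₚ.<-≤-trans i<k k≤m)))

  poch-negative-vanishes : ∀ n → poch (- fromℕ n) (suc n) ≈ 0#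
  poch-negative-vanishes n = trans (*-congˡ (-‿inverseˡ (fromℕ n))) (zeroʳ _)

  ^-cong : ∀ {a b} k → a ≈ b → a ^ k ≈ b ^ k
  ^-cong zero    a≈b = refl
  ^-cong (suc k) a≈b = *-cong (^-cong k a≈b) a≈b

  ^-distribʳ-* : ∀ a b k → (a * b) ^ k ≈ a ^ k * b ^ k
  ^-distribʳ-* a b zero    = sym (*-identityˡ 1#)
  ^-distribʳ-* a b (suc k) = trans (*-congʳ (^-distribʳ-* a b k))
    (solve 4 (λ a b p q → p :* q :* (a :* b) := p :* a :* (q :* b)) refl a b (a ^ k) (b ^ k))

  sumTo-cong : ∀ n {f g : ℕ → Carrier} → (∀ k → k ℕ.≤ n → f k ≈ g k) → sumTo n f ≈ sumTo n g
  sumTo-cong zero    f≈g = f≈g 0 ℕ.z≤n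
  sumTo-cong (suc n) f≈g =
    +-cong (sumTo-cong n (λ k k≤n → f≈g k (ℕₚ.m≤n⇒m≤1+n k≤n))) (f≈g (suc n) ℕₚ.≤-refl)

  sumTo-+ : ∀ n (f g : ℕ → Carrier) → sumTo n (λ k → f k + g k) ≈ sumTo n f + sumTo n g
  sumTo-+ zero    f g = refl
  sumTo-+ (suc n) f g = trans (+-congʳ (sumTo-+ n f g))
    (solve 4 (λ a b c d → a :+ b :+ (c :+ d) := a :+ c :+ (b :+ d)) refl _ _ _ _)

  sumTo-*ˡ : ∀ n a (f : ℕ → Carrier) → a * sumTo n f ≈ sumTo n (λ k → a * f k)
  sumTo-*ˡ zero    a f = refl
  sumTo-*ˡ (suc n) a f = trans (distribˡ _ _ _) (+-congʳ (sumTo-*ˡ n a f))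

  sumTo-sucˡ : ∀ n (f : ℕ → Carrier) → sumTo (suc n) f ≈ f 0 + sumTo n (λ k → f (suc k))
  sumTo-sucˡ zero    f = refl
  sumTo-sucˡ (suc n) f = trans (+-congʳ (sumTo-sucˡ n f)) (+-assoc _ _ _)

  W A : Carrier → Carrier
  W J = (1# + fromℕ 2 * J) * (fromℕ 2 + fromℕ 2 * J)
  A N = (1# + fromℕ 3 * N) * (fromℕ 2 + fromℕ 3 * N)

  L Q : Carrier → Carrier → Carrier
  L N J = (J - fromℕ 3 * N - fromℕ 2) * (J - fromℕ 3 * N - 1#)
  Q N y = (1# + fromℕ 3 * N + y) * (fromℕ 2 + fromℕ 3 * N - y)

  K : ℕ → Carrier
  K k = fromℕ k * (1# + fromℕ k)

  -- Copies of W, A, L and Q in the solver's syntax: ⟦ :A N ⟧ ρ reduces to A (⟦ N ⟧ ρ).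
  :W :A : ∀ {m} → Polynomial m → Polynomial m
  :W J = (:1 :+ con (+ 2) :* J) :* (con (+ 2) :+ con (+ 2) :* J)
  :A N = (:1 :+ con (+ 3) :* N) :* (con (+ 2) :+ con (+ 3) :* N)

  :L :Q : ∀ {m} → Polynomial m → Polynomial m → Polynomial m
  :L N J = (J :- con (+ 3) :* N :- con (+ 2)) :* (J :- con (+ 3) :* N :- :1)
  :Q N y = (:1 :+ con (+ 3) :* N :+ y) :* (con (+ 2) :+ con (+ 3) :* N :- y)

  fromℕ-[2[1+j]]! : ∀ j → fromℕ ((2 ℕ.* suc j) !) ≈ fromℕ ((2 ℕ.* j) !) * W (fromℕ j)
  fromℕ-[2[1+j]]! j = begin
    fromℕ ((2 ℕ.* suc j) !)                     ≡⟨ ≡.cong (λ m → fromℕ (m !)) (ℕₚ.*-suc 2 j) ⟩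
    fromℕ (suc (suc m) ℕ.* (suc m ℕ.* m !))     ≈⟨ trans (fromℕ-* (suc (suc m)) (suc m ℕ.* m !))
                                                         (*-congˡ (fromℕ-* (suc m) (m !))) ⟩
    (1# + (1# + M)) * ((1# + M) * fromℕ (m !))  ≈⟨ *-cong (+-congˡ (+-congˡ M≈2J)) (*-congʳ (+-congˡ M≈2J)) ⟩
    (1# + (1# + fromℕ 2 * J)) * ((1# + fromℕ 2 * J) * fromℕ (m !))
      ≈⟨ solve 2 (λ J f → (:1 :+ (:1 :+ con (+ 2) :* J)) :* ((:1 :+ con (+ 2) :* J) :* f) := f :* :W J)
           refl J (fromℕ (m !)) ⟩
    fromℕ (m !) * W J                           ∎
    where
    m = 2 ℕ.* j
    M = fromℕ m
    J = fromℕ j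
    M≈2J : M ≈ fromℕ 2 * J
    M≈2J = fromℕ-* 2 j

  factorial-duplication : ∀ {h} → fromℕ 2 * h ≈ 1# → ∀ k →
                          fromℕ ((2 ℕ.* k) !) ≈ fromℕ 4 ^ k * (fromℕ (k !) * poch h k)
  factorial-duplication _ zero = solve 0 (con (+ 1) := :1 :* (con (+ 1) :* :1)) refl
  factorial-duplication {h} 2h≈1 (suc k) = begin
    fromℕ ((2 ℕ.* suc k) !)                                     ≈⟨ fromℕ-[2[1+j]]! k ⟩
    fromℕ ((2 ℕ.* k) !) * W k′
      ≈⟨ *-cong (factorial-duplication 2h≈1 k) (*-congʳ (+-congʳ (sym 2h≈1))) ⟩
    fromℕ 4 ^ k * (fromℕ (k !) * poch h k) * ((fromℕ 2 * h + fromℕ 2 * k′) * (fromℕ 2 + fromℕ 2 * k′))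
      ≈⟨ solve 5 (λ p f q h k → p :* (f :* q) :* ((con (+ 2) :* h :+ con (+ 2) :* k) :* (con (+ 2) :+ con (+ 2) :* k))
                            := p :* con (+ 4) :* ((:1 :+ k) :* f :* (q :* (h :+ k))))
           refl (fromℕ 4 ^ k) (fromℕ (k !)) (poch h k) h k′ ⟩
    fromℕ 4 ^ suc k * ((1# + k′) * fromℕ (k !) * poch h (suc k)) ≈⟨ *-congˡ (*-congʳ (fromℕ-* (suc k) (k !))) ⟨
    fromℕ 4 ^ suc k * (fromℕ (suc k !) * poch h (suc k))         ∎
    where k′ = fromℕ k

  -- (¾)ᵏ / (k! (½)ₖ) = 3ᵏ / (2k)! by factorial-duplication. For k > 3n the denominator is 0 and
  -- its inverse is junk, but coeff n (suc n) is 0 through its numerator even when n = 0.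
  coeff : ℕ → ℕ → Carrier
  coeff n k = poch (- fromℕ n) k * fromℕ 3 ^ k / (fromℕ ((2 ℕ.* k) !) * poch (- fromℕ (3 ℕ.* n)) k)

  coeff-denominator-≉0 : ∀ n {k} → k ℕ.≤ 3 ℕ.* n →
                         fromℕ ((2 ℕ.* k) !) * poch (- fromℕ (3 ℕ.* n)) k ≉ 0#
  coeff-denominator-≉0 n {k} k≤3n = *-≉0 (fromℕ-≉0 _ {{(2 ℕ.* k) ℕₚ.!≢0}}) (poch-negative-≉0 k≤3n)

  coeff-zero : ∀ n → coeff n 0 ≈ 1#
  coeff-zero n =
    trans (*-cong (*-identityˡ 1#) (x≈1⇒x⁻¹≈1 (trans (*-identityʳ _) (+-identityʳ 1#)))) (*-identityˡ 1#)

  coeff-vanishes : ∀ n → coeff n (suc n) ≈ 0#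
  coeff-vanishes n = trans (*-congʳ (trans (*-congʳ (poch-negative-vanishes n)) (zeroˡ _))) (zeroˡ _)

  coeff-ratioₖ : ∀ {n j} → j ℕ.< n →
    coeff n (suc j) * (W (fromℕ j) * (fromℕ j - fromℕ 3 * fromℕ n))
      ≈ coeff n j * (fromℕ 3 * (fromℕ j - fromℕ n))
  coeff-ratioₖ {n} {j} j<n =
    cross-multiply (coeff-denominator-≉0 n 1+j≤3n) (coeff-denominator-≉0 n (ℕₚ.<⇒≤ 1+j≤3n)) (begin
      u * (- N + J) * (T * fromℕ 3) * (W J * X) * (f * w)
        ≈⟨ solve 8 (λ u N J T WJ X f w →
                      u :* (:- N :+ J) :* (T :* con (+ 3)) :* (WJ :* X) :* (f :* w)
                   := u :* T :* (con (+ 3) :* (J :- N)) :* (f :* WJ :* (w :* X)))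
             refl u N J T (W J) X f w ⟩
      u * T * (fromℕ 3 * (J - N)) * (f * W J * (w * X))
        ≈⟨ *-congˡ (*-cong (sym (fromℕ-[2[1+j]]! j)) (*-congˡ X≈-3n+J)) ⟩
      u * T * (fromℕ 3 * (J - N)) * (fromℕ ((2 ℕ.* suc j) !) * (w * (- fromℕ (3 ℕ.* n) + J))) ∎)
    where
    N = fromℕ n
    J = fromℕ j
    X = J - fromℕ 3 * N
    u = poch (- N) j
    T = fromℕ 3 ^ j
    f = fromℕ ((2 ℕ.* j) !)
    w = poch (- fromℕ (3 ℕ.* n)) j
    1+j≤3n : suc j ℕ.≤ 3 ℕ.* n
    1+j≤3n = ℕₚ.≤-trans j<n (ℕₚ.m≤n*m n 3)
    X≈-3n+J : X ≈ - fromℕ (3 ℕ.* n) + J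
    X≈-3n+J = trans (+-comm _ _) (+-congʳ (-‿cong (sym (fromℕ-* 3 n))))

  poch-negative-sucˡ : ∀ n j → poch (- fromℕ (suc n)) (suc j) ≈ - (1# + fromℕ n) * poch (- fromℕ n) j
  poch-negative-sucˡ n j = trans (poch-sucˡ (- (1# + N)) j)
    (*-congˡ (poch-cong j (solve 1 (λ N → :- (:1 :+ N) :+ :1 := :- N) refl N)))
    where N = fromℕ n

  poch-negative-triple-shift : ∀ n j →
    poch (- fromℕ (3 ℕ.* suc n)) (suc j) * L (fromℕ n) (fromℕ j)
      ≈ - (fromℕ 3 * (1# + fromℕ n)) * A (fromℕ n) * poch (- fromℕ (3 ℕ.* n)) j
  poch-negative-triple-shift n j = begin
    poch (- fromℕ (3 ℕ.* suc n)) (suc j) * L N J ≈⟨ *-congʳ (poch-cong (suc j) (-‿cong (fromℕ-* 3 (suc n)))) ⟩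
    poch a (suc j) * L N J
      ≈⟨ solve 3 (λ p N J → p :* :L N J := p :* (:a N :+ (:1 :+ J)) :* (:a N :+ (:1 :+ (:1 :+ J))))
           refl (poch a (suc j)) N J ⟩
    poch a (3 ℕ.+ j)                             ≈⟨ poch-+ a 3 j ⟩
    poch a 3 * poch (a + fromℕ 3) j
      ≈⟨ *-cong (solve 1 (λ N → :1 :* (:a N :+ con (+ 0)) :* (:a N :+ con (+ 1)) :* (:a N :+ con (+ 2))
                              := :a N :* :A N) refl N)
                (poch-cong j (trans (solve 1 (λ N → :a N :+ con (+ 3) := :- (con (+ 3) :* N)) refl N)
                                    (-‿cong (sym (fromℕ-* 3 n))))) ⟩
    a * A N * poch (- fromℕ (3 ℕ.* n)) j         ∎
    where
    N = fromℕ n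
    J = fromℕ j
    a = - (fromℕ 3 * (1# + N))
    :a : ∀ {m} → Polynomial m → Polynomial m
    :a N = :- (con (+ 3) :* (:1 :+ N))

  coeff-ratioₙₖ : ∀ {n j} → j ℕ.≤ n →
    coeff (suc n) (suc j) * (W (fromℕ j) * A (fromℕ n)) ≈ coeff n j * L (fromℕ n) (fromℕ j)
  coeff-ratioₙₖ {n} {j} j≤n =
    cross-multiply (coeff-denominator-≉0 (suc n) 1+j≤3[1+n]) (coeff-denominator-≉0 n j≤3n) (begin
      poch (- fromℕ (suc n)) (suc j) * (T * fromℕ 3) * (W J * A N) * (f * w)
        ≈⟨ *-congʳ (*-congʳ (*-congʳ (poch-negative-sucˡ n j))) ⟩
      - (1# + N) * u * (T * fromℕ 3) * (W J * A N) * (f * w)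
        ≈⟨ solve 7 (λ N u T WJ AN f w →
                      :- (:1 :+ N) :* u :* (T :* con (+ 3)) :* (WJ :* AN) :* (f :* w)
                   := u :* T :* (f :* WJ) :* (:- (con (+ 3) :* (:1 :+ N)) :* AN :* w))
             refl N u T (W J) (A N) f w ⟩
      u * T * (f * W J) * (- (fromℕ 3 * (1# + N)) * A N * w)
        ≈⟨ *-congˡ (poch-negative-triple-shift n j) ⟨
      u * T * (f * W J) * (p * L N J)
        ≈⟨ solve 5 (λ u T fW p L → u :* T :* fW :* (p :* L) := u :* T :* L :* (fW :* p))
             refl u T (f * W J) p (L N J) ⟩
      u * T * L N J * (f * W J * p)
        ≈⟨ *-congˡ (*-congʳ (fromℕ-[2[1+j]]! j)) ⟨
      u * T * L N J * (fromℕ ((2 ℕ.* suc j) !) * p) ∎)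
    where
    N = fromℕ n
    J = fromℕ j
    u = poch (- N) j
    T = fromℕ 3 ^ j
    f = fromℕ ((2 ℕ.* j) !)
    w = poch (- fromℕ (3 ℕ.* n)) j
    p = poch (- fromℕ (3 ℕ.* suc n)) (suc j)
    j≤3n : j ℕ.≤ 3 ℕ.* n
    j≤3n = ℕₚ.≤-trans j≤n (ℕₚ.m≤n*m n 3)
    1+j≤3[1+n] : suc j ℕ.≤ 3 ℕ.* suc n
    1+j≤3[1+n] = ℕₚ.≤-trans (ℕ.s≤s j≤n) (ℕₚ.m≤n*m (suc n) 3)

  contiguity-identity : ∀ N J →
    (J - fromℕ 3 * N) * L N J
      ≈ fromℕ 3 * (A N - (1# + J) * (1# + (1# + J))) * (J - N) + W J * (J - fromℕ 3 * N)
  contiguity-identity = solve 2 (λ N J →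
      (J :- con (+ 3) :* N) :* :L N J
    := con (+ 3) :* (:A N :- (:1 :+ J) :* (:1 :+ (:1 :+ J))) :* (J :- N) :+ :W J :* (J :- con (+ 3) :* N)) refl

  L-diagonal : ∀ N → L N N ≈ W N
  L-diagonal = solve 1 (λ N → :L N N := :W N) refl

  fromℕ[1+b]+a*m≉0 : ∀ b a m → fromℕ (suc b) + fromℕ a * fromℕ m ≉ 0#
  fromℕ[1+b]+a*m≉0 b a m =
    ≉0-resp-≈ (trans (fromℕ-+ (suc b) (a ℕ.* m)) (+-congˡ (fromℕ-* a m))) (char-zero (b ℕ.+ a ℕ.* m))

  1+a*m≉0 : ∀ a m → 1# + fromℕ a * fromℕ m ≉ 0#
  1+a*m≉0 a m = ≉0-resp-≈ (+-congʳ (+-identityʳ 1#)) (fromℕ[1+b]+a*m≉0 0 a m)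

  A-≉0 : ∀ n → A (fromℕ n) ≉ 0#
  A-≉0 n = *-≉0 (1+a*m≉0 3 n) (fromℕ[1+b]+a*m≉0 1 3 n)

  W-≉0 : ∀ j → W (fromℕ j) ≉ 0#
  W-≉0 j = *-≉0 (1+a*m≉0 2 j) (fromℕ[1+b]+a*m≉0 1 2 j)

  coeff-contiguous : ∀ {n j} → j ℕ.≤ n →
    A (fromℕ n) * coeff (suc n) (suc j) ≈ (A (fromℕ n) - K (suc j)) * coeff n (suc j) + coeff n j
  coeff-contiguous {n} {j} j≤n with ℕₚ.m≤n⇒m<n∨m≡n j≤n
  ... | inj₁ j<n = *-cancelˡ (*-≉0 (*-≉0 (W-≉0 j) (A-≉0 n)) X≉0) (begin
    W J * A N * X * (A N * c₁)   ≈⟨ solve 4 (λ W A X c → W :* A :* X :* (A :* c) := A :* X :* (c :* (W :* A)))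
                                      refl (W J) (A N) X c₁ ⟩
    A N * X * (c₁ * (W J * A N)) ≈⟨ *-congˡ (coeff-ratioₙₖ j≤n) ⟩
    A N * X * (c₀ * L N J)       ≈⟨ solve 4 (λ A X c L → A :* X :* (c :* L) := A :* c :* (X :* L))
                                      refl (A N) X c₀ (L N J) ⟩
    A N * c₀ * (X * L N J)       ≈⟨ *-congˡ (contiguity-identity N J) ⟩
    A N * c₀ * (fromℕ 3 * (A N - K (suc j)) * (J - N) + W J * X)
      ≈⟨ solve 7 (λ A K c N J W X → A :* c :* (con (+ 3) :* (A :- K) :* (J :- N) :+ W :* X)
                                 := (A :- K) :* A :* (c :* (con (+ 3) :* (J :- N))) :+ W :* A :* X :* c)
           refl (A N) (K (suc j)) c₀ N J (W J) X ⟩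
    (A N - K (suc j)) * A N * (c₀ * (fromℕ 3 * (J - N))) + W J * A N * X * c₀
      ≈⟨ +-congʳ (*-congˡ (coeff-ratioₖ j<n)) ⟨
    (A N - K (suc j)) * A N * (c₂ * (W J * X)) + W J * A N * X * c₀
      ≈⟨ solve 6 (λ A K c₂ W X c₀ → (A :- K) :* A :* (c₂ :* (W :* X)) :+ W :* A :* X :* c₀
                                 := W :* A :* X :* ((A :- K) :* c₂ :+ c₀))
           refl (A N) (K (suc j)) c₂ (W J) X c₀ ⟩
    W J * A N * X * ((A N - K (suc j)) * c₂ + c₀) ∎)
    where
    N = fromℕ n
    J = fromℕ j
    X = J - fromℕ 3 * N
    c₀ = coeff n j
    c₁ = coeff (suc n) (suc j)
    c₂ = coeff n (suc j)
    X≉0 : X ≉ 0#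
    X≉0 = ≉0-resp-≈ (trans (+-congʳ (-‿cong (fromℕ-* 3 n))) (+-comm _ _))
            (-fromℕ+fromℕ≉0 (ℕₚ.<⇒≢ (ℕₚ.<-≤-trans j<n (ℕₚ.m≤n*m n 3))))
  ... | inj₂ ≡.refl = *-cancelˡ (*-≉0 (W-≉0 n) (A-≉0 n)) (begin
    W N * A N * (A N * c₁)       ≈⟨ solve 3 (λ W A c → W :* A :* (A :* c) := A :* (c :* (W :* A))) refl (W N) (A N) c₁ ⟩
    A N * (c₁ * (W N * A N))     ≈⟨ *-congˡ (coeff-ratioₙₖ j≤n) ⟩
    A N * (c₀ * L N N)           ≈⟨ *-congˡ (*-congˡ (L-diagonal N)) ⟩
    A N * (c₀ * W N)             ≈⟨ solve 3 (λ W A c → A :* (c :* W) := W :* A :* c) refl (W N) (A N) c₀ ⟩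
    W N * A N * c₀
      ≈⟨ *-congˡ (trans (+-congʳ (trans (*-congˡ (coeff-vanishes n)) (zeroʳ _))) (+-identityˡ c₀)) ⟨
    W N * A N * ((A N - K (suc n)) * coeff n (suc n) + c₀) ∎)
    where
    N = fromℕ n
    c₀ = coeff n n
    c₁ = coeff (suc n) (suc n)

  V : Carrier → ℕ → Carrier
  V y k = poch y k * poch (1# - y) k

  V-step : ∀ N y k → Q N y * V y k ≈ (A N - K k) * V y k + V y (suc k)
  V-step N y k = solve 5 (λ N y k p q →
      :Q N y :* (p :* q) := (:A N :- k :* (:1 :+ k)) :* (p :* q) :+ p :* (y :+ k) :* (q :* (:1 :- y :+ k)))
    refl N y (fromℕ k) (poch y k) (poch (1# - y) k)

  V-cong : ∀ {y y′} k → y ≈ y′ → V y k ≈ V y′ k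
  V-cong k y≈y′ = *-cong (poch-cong k y≈y′) (poch-cong k (+-congˡ (-‿cong y≈y′)))

  S : ℕ → Carrier → Carrier
  S n y = sumTo n (λ k → coeff n k * V y k)

  S-cong : ∀ n {y y′} → y ≈ y′ → S n y ≈ S n y′
  S-cong n y≈y′ = sumTo-cong n (λ k _ → *-congˡ (V-cong k y≈y′))

  S-recurrence : ∀ n y → Q (fromℕ n) y * S n y ≈ A (fromℕ n) * S (suc n) y
  S-recurrence n y = begin
    Q N y * S n y                                    ≈⟨ sumTo-*ˡ n (Q N y) _ ⟩
    sumTo n (λ k → Q N y * (coeff n k * V y k))      ≈⟨ sumTo-cong n (λ k _ → split k) ⟩
    sumTo n (λ k → g k + h k)                        ≈⟨ sumTo-+ n g h ⟩
    sumTo n g + sumTo n h                            ≈⟨ +-congʳ (trans (+-congˡ g[1+n]≈0) (+-identityʳ _)) ⟨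
    sumTo (suc n) g + sumTo n h                      ≈⟨ +-congʳ (sumTo-sucˡ n g) ⟩
    g 0 + sumTo n (λ j → g (suc j)) + sumTo n h      ≈⟨ +-assoc _ _ _ ⟩
    g 0 + (sumTo n (λ j → g (suc j)) + sumTo n h)    ≈⟨ +-cong g0 (sumTo-+ n (λ j → g (suc j)) h) ⟨
    t 0 + sumTo n (λ j → g (suc j) + h j)            ≈⟨ +-congˡ (sumTo-cong n (λ j j≤n → contiguous j j≤n)) ⟩
    t 0 + sumTo n (λ j → t (suc j))                  ≈⟨ sumTo-sucˡ n t ⟨
    sumTo (suc n) t                                  ≈⟨ sumTo-*ˡ (suc n) (A N) _ ⟨
    A N * S (suc n) y                                ∎
    where
    N = fromℕ n
    g h t : ℕ → Carrier
    g k = (A N - K k) * coeff n k * V y k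
    h k = coeff n k * V y (suc k)
    t k = A N * (coeff (suc n) k * V y k)
    split : ∀ k → Q N y * (coeff n k * V y k) ≈ g k + h k
    split k = begin
      Q N y * (coeff n k * V y k)
        ≈⟨ solve 3 (λ q c v → q :* (c :* v) := c :* (q :* v)) refl (Q N y) (coeff n k) (V y k) ⟩
      coeff n k * (Q N y * V y k)                 ≈⟨ *-congˡ (V-step N y k) ⟩
      coeff n k * ((A N - K k) * V y k + V y (suc k))
        ≈⟨ solve 4 (λ c a v v′ → c :* (a :* v :+ v′) := a :* c :* v :+ c :* v′)
             refl (coeff n k) (A N - K k) (V y k) (V y (suc k)) ⟩
      g k + h k                                   ∎
    g[1+n]≈0 : g (suc n) ≈ 0#
    g[1+n]≈0 = trans (*-congʳ (trans (*-congˡ (coeff-vanishes n)) (zeroʳ _))) (zeroˡ _)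
    g0 : t 0 ≈ g 0
    g0 = solve 3 (λ A c v → A :* (c :* v) := (A :- con (+ 0) :* (:1 :+ con (+ 0))) :* c :* v)
           refl (A N) (coeff n 0) (V y 0)
    contiguous : ∀ j → j ℕ.≤ n → g (suc j) + h j ≈ t (suc j)
    contiguous j j≤n = begin
      g (suc j) + h j ≈⟨ solve 4 (λ a c₂ c₀ v → a :* c₂ :* v :+ c₀ :* v := (a :* c₂ :+ c₀) :* v)
                           refl (A N - K (suc j)) (coeff n (suc j)) (coeff n j) (V y (suc j)) ⟩
      ((A N - K (suc j)) * coeff n (suc j) + coeff n j) * V y (suc j) ≈⟨ *-congʳ (coeff-contiguous j≤n) ⟨
      A N * coeff (suc n) (suc j) * V y (suc j) ≈⟨ *-assoc _ _ _ ⟩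
      t (suc j) ∎

  ⅓ ⅔ ½ : Carrier
  ⅓ = 1# / fromℕ 3
  ⅔ = fromℕ 2 / fromℕ 3
  ½ = 1# / fromℕ 2

  3*[⅓+a] : ∀ a → fromℕ 3 * (⅓ + a) ≈ 1# + fromℕ 3 * a
  3*[⅓+a] a = trans (distribˡ _ _ _) (+-congʳ (y*[x/y]≈x 1# (fromℕ-≉0 3)))

  3*[⅔+a] : ∀ a → fromℕ 3 * (⅔ + a) ≈ fromℕ 2 + fromℕ 3 * a
  3*[⅔+a] a = trans (distribˡ _ _ _) (+-congʳ (y*[x/y]≈x (fromℕ 2) (fromℕ-≉0 3)))

  closed-form : ∀ n x → poch (⅓ + x) n * poch (⅔ - x) n ≈ poch ⅓ n * poch ⅔ n * S n (fromℕ 3 * x)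
  closed-form zero x = sym (trans (*-congˡ (*-congʳ (coeff-zero 0)))
                                  (solve 0 (:1 :* :1 :* (:1 :* (:1 :* :1)) := :1 :* :1) refl))
  closed-form (suc n) x = *-cancelˡ (*-≉0 (fromℕ-≉0 3) (fromℕ-≉0 3)) (begin
    fromℕ 3 * fromℕ 3 * (poch (⅓ + x) n * (⅓ + x + N) * (poch (⅔ - x) n * (⅔ - x + N)))
      ≈⟨ solve 6 (λ p q t t′ x N → con (+ 3) :* con (+ 3) :* (p :* (t :+ x :+ N) :* (q :* (t′ :- x :+ N)))
                                := p :* q :* (con (+ 3) :* (t :+ (x :+ N)) :* (con (+ 3) :* (t′ :+ (N :- x)))))
           refl (poch (⅓ + x) n) (poch (⅔ - x) n) ⅓ ⅔ x N ⟩
    poch (⅓ + x) n * poch (⅔ - x) n * (fromℕ 3 * (⅓ + (x + N)) * (fromℕ 3 * (⅔ + (N - x))))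
      ≈⟨ *-cong (closed-form n x) (*-cong (3*[⅓+a] (x + N)) (3*[⅔+a] (N - x))) ⟩
    poch ⅓ n * poch ⅔ n * S n y * ((1# + fromℕ 3 * (x + N)) * (fromℕ 2 + fromℕ 3 * (N - x)))
      ≈⟨ solve 4 (λ β s x N → β :* s :* ((:1 :+ con (+ 3) :* (x :+ N)) :* (con (+ 2) :+ con (+ 3) :* (N :- x)))
                           := β :* (:Q N (con (+ 3) :* x) :* s))
           refl (poch ⅓ n * poch ⅔ n) (S n y) x N ⟩
    poch ⅓ n * poch ⅔ n * (Q N y * S n y)
      ≈⟨ *-congˡ (S-recurrence n y) ⟩
    poch ⅓ n * poch ⅔ n * (A N * S (suc n) y)
      ≈⟨ *-congˡ (*-congʳ (*-cong (3*[⅓+a] N) (3*[⅔+a] N))) ⟨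
    poch ⅓ n * poch ⅔ n * (fromℕ 3 * (⅓ + N) * (fromℕ 3 * (⅔ + N)) * S (suc n) y)
      ≈⟨ solve 6 (λ p q t t′ N s → p :* q :* (con (+ 3) :* (t :+ N) :* (con (+ 3) :* (t′ :+ N)) :* s)
                                := con (+ 3) :* con (+ 3) :* (p :* (t :+ N) :* (q :* (t′ :+ N)) :* s))
           refl (poch ⅓ n) (poch ⅔ n) ⅓ ⅔ N (S (suc n) y) ⟩
    fromℕ 3 * fromℕ 3 * (poch ⅓ (suc n) * poch ⅔ (suc n) * S (suc n) y) ∎)
    where
    N = fromℕ n
    y = fromℕ 3 * x

  S-closed-form : ∀ n x → S n (fromℕ 3 * x) ≈ poch (⅓ + x) n * poch (⅔ - x) n / (poch ⅓ n * poch ⅔ n)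
  S-closed-form n x = x*y≈z⇒y≈z/x β≉0 (sym (closed-form n x))
    where
    3*⅓≈1 : fromℕ 3 * ⅓ ≈ fromℕ 1
    3*⅓≈1 = trans (y*[x/y]≈x 1# (fromℕ-≉0 3)) (sym (+-identityʳ 1#))
    β≉0 : poch ⅓ n * poch ⅔ n ≉ 0#
    β≉0 = *-≉0 (poch-≉0 n (λ i _ → positive+fromℕ≉0 3 0 3*⅓≈1 i))
               (poch-≉0 n (λ i _ → positive+fromℕ≉0 3 1 (y*[x/y]≈x (fromℕ 2) (fromℕ-≉0 3)) i))

  V-symmetric : ∀ y k → V y k + V (- y) k ≈ fromℕ 2 * (poch y k * poch (- y) k)
  V-symmetric y zero    = solve 0 (:1 :* :1 :+ :1 :* :1 := con (+ 2) :* (:1 :* :1)) refl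
  V-symmetric y (suc m) = begin
    poch y (suc m) * poch (1# - y) (suc m) + poch (- y) (suc m) * poch (1# - - y) (suc m)
      ≈⟨ +-cong (*-cong (poch-sucˡ y m) (*-congʳ (poch-cong m (+-comm 1# (- y)))))
                (*-cong (poch-sucˡ (- y) m) (*-congʳ (poch-cong m (solve 1 (λ y → :1 :- :- y := y :+ :1) refl y)))) ⟩
    y * a * (b * (1# - y + M)) + - y * b * (a * (1# - - y + M))
      ≈⟨ solve 4 (λ y a b M → y :* a :* (b :* (:1 :- y :+ M)) :+ :- y :* b :* (a :* (:1 :- :- y :+ M))
                           := con (+ 2) :* (y :* a :* (:- y :* b))) refl y a b M ⟩
    fromℕ 2 * (y * a * (- y * b))
      ≈⟨ *-congˡ (*-cong (poch-sucˡ y m) (poch-sucˡ (- y) m)) ⟨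
    fromℕ 2 * (poch y (suc m) * poch (- y) (suc m)) ∎
    where
    M = fromℕ m
    a = poch (y + 1#) m
    b = poch (- y + 1#) m

  2*½≈1 : fromℕ 2 * ½ ≈ 1#
  2*½≈1 = y*[x/y]≈x 1# (fromℕ-≉0 2)

  hypergeometric-term : ∀ n k y → k ℕ.≤ 3 ℕ.* n →
    poch y k * poch (- y) k * poch (- fromℕ n) k * (fromℕ 3 / fromℕ 4) ^ k
      / (fromℕ (k !) * poch ½ k * poch (- fromℕ (3 ℕ.* n)) k)
    ≈ coeff n k * (poch y k * poch (- y) k)
  hypergeometric-term n k y k≤3n = begin
    P₁ * P₂ * u * Z / b  ≈⟨ solve 5 (λ P₁ P₂ u Z b⁻¹ → P₁ :* P₂ :* u :* Z :* b⁻¹ := u :* Z :* b⁻¹ :* (P₁ :* P₂))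
                              refl P₁ P₂ u Z (b ⁻¹) ⟩
    u * Z / b * (P₁ * P₂) ≈⟨ cross-multiply b≉0 (coeff-denominator-≉0 n k≤3n) (begin
      u * Z * (P₁ * P₂) * (fromℕ ((2 ℕ.* k) !) * w)
        ≈⟨ *-congˡ (*-congʳ (factorial-duplication 2*½≈1 k)) ⟩
      u * Z * (P₁ * P₂) * (fromℕ 4 ^ k * (f * v) * w)
        ≈⟨ solve 7 (λ u Z P F f v w → u :* Z :* P :* (F :* (f :* v) :* w) := u :* (Z :* F) :* P :* (f :* v :* w))
             refl u Z (P₁ * P₂) (fromℕ 4 ^ k) f v w ⟩
      u * (Z * fromℕ 4 ^ k) * (P₁ * P₂) * b
        ≈⟨ *-congʳ (*-congʳ (*-congˡ Z*4^k≈3^k)) ⟩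
      u * fromℕ 3 ^ k * (P₁ * P₂) * b ∎) ⟩
    coeff n k * (P₁ * P₂) ∎
    where
    z = fromℕ 3 / fromℕ 4
    P₁ = poch y k
    P₂ = poch (- y) k
    u = poch (- fromℕ n) k
    Z = z ^ k
    f = fromℕ (k !)
    v = poch ½ k
    w = poch (- fromℕ (3 ℕ.* n)) k
    b = f * v * w
    b≉0 : b ≉ 0#
    b≉0 = *-≉0 (x*y≉0⇒y≉0 (≉0-resp-≈ (factorial-duplication 2*½≈1 k) (fromℕ-≉0 _ {{(2 ℕ.* k) ℕₚ.!≢0}})))
               (poch-negative-≉0 k≤3n)
    Z*4^k≈3^k : Z * fromℕ 4 ^ k ≈ fromℕ 3 ^ k
    Z*4^k≈3^k = trans (sym (^-distribʳ-* z (fromℕ 4) k)) (^-cong k (x/y*y≈x (fromℕ 3) (fromℕ-≉0 4)))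

  F32-symmetrised : ∀ n y →
    F32 y (- y) n ½ (- fromℕ (3 ℕ.* n)) (fromℕ 3 / fromℕ 4) ≈ ½ * S n y + ½ * S n (- y)
  F32-symmetrised n y = begin
    F32 y (- y) n ½ (- fromℕ (3 ℕ.* n)) (fromℕ 3 / fromℕ 4)
      ≈⟨ sumTo-cong n (λ k k≤n → trans (hypergeometric-term n k y (ℕₚ.≤-trans k≤n (ℕₚ.m≤n*m n 3)))
                                      (halve k)) ⟩
    sumTo n (λ k → ½ * (coeff n k * V y k) + ½ * (coeff n k * V (- y) k))
      ≈⟨ sumTo-+ n _ _ ⟩
    sumTo n (λ k → ½ * (coeff n k * V y k)) + sumTo n (λ k → ½ * (coeff n k * V (- y) k))
      ≈⟨ +-cong (sumTo-*ˡ n ½ _) (sumTo-*ˡ n ½ _) ⟨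
    ½ * S n y + ½ * S n (- y) ∎
    where
    halve : ∀ k → coeff n k * (poch y k * poch (- y) k)
                  ≈ ½ * (coeff n k * V y k) + ½ * (coeff n k * V (- y) k)
    halve k = begin
      cₖ * P                         ≈⟨ *-identityˡ _ ⟨
      1# * (cₖ * P)                   ≈⟨ *-congʳ 2*½≈1 ⟨
      fromℕ 2 * ½ * (cₖ * P)          ≈⟨ solve 3 (λ h c P → con (+ 2) :* h :* (c :* P) := h :* (c :* (con (+ 2) :* P)))
                                          refl ½ cₖ P ⟩
      ½ * (cₖ * (fromℕ 2 * P))        ≈⟨ *-congˡ (*-congˡ (V-symmetric y k)) ⟨
      ½ * (cₖ * (V y k + V (- y) k))  ≈⟨ solve 4 (λ h c v v′ → h :* (c :* (v :+ v′)) := h :* (c :* v) :+ h :* (c :* v′))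
                                          refl ½ cₖ (V y k) (V (- y) k) ⟩
      ½ * (cₖ * V y k) + ½ * (cₖ * V (- y) k) ∎
      where
      cₖ = coeff n k
      P = poch y k * poch (- y) k

corollary4 : ∀ {c ℓ} (F : CharZeroField c ℓ) →
    let open FieldOps F
        half   = 1# / fromℕ 2
        third  = 1# / fromℕ 3
        2third = fromℕ 2 / fromℕ 3
    in ∀ (n : ℕ) (x : Carrier) →
       F32 (fromℕ 3 * x) (- (fromℕ 3 * x)) n half (- fromℕ (3 Data.Nat.* n)) (fromℕ 3 / fromℕ 4)
       ≈ half * ((poch (third + x) n * poch (2third - x) n) / (poch third n * poch 2third n))
         + half * ((poch (2third + x) n * poch (third - x) n) / (poch third n * poch 2third n))
corollary4 F n x = begin
  F32 y (- y) n ½ (- fromℕ (3 ℕ.* n)) (fromℕ 3 / fromℕ 4) ≈⟨ F32-symmetrised n y ⟩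
  ½ * S n y + ½ * S n (- y)
    ≈⟨ +-cong (*-congˡ (S-closed-form n x))
              (*-congˡ (trans (S-cong n (-‿distribʳ-* _ _)) (S-closed-form n (- x)))) ⟩
  ½ * (poch (⅓ + x) n * poch (⅔ - x) n / β) + ½ * (poch (⅓ - x) n * poch (⅔ - - x) n / β)
    ≈⟨ +-congˡ (*-congˡ (*-congʳ (trans (*-comm _ _) (*-congʳ (poch-cong n (+-congˡ (-‿involutive x))))))) ⟩
  ½ * (poch (⅓ + x) n * poch (⅔ - x) n / β) + ½ * (poch (⅔ + x) n * poch (⅓ - x) n / β) ∎
  where
  open FieldOps F
  open Summation F
  open RingProperties ring
  open SetoidReasoning setoid
  y = fromℕ 3 * x
  β = poch ⅓ n * poch ⅔ n
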